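{- For any integer $t>0$, any integer-valued function $f(n)\in O(n^t)$, and any desired bound $\varepsilon_{\mathrm{premature}}>0$, there exists a two-way probabilistic finite automaton whose expected runtime on inputs of length $n$ is in $O(n^{t+1})$, such that, on every input of length $n$, the probability that this machine halts in fewer than $f(n)$ time-steps is at most $\varepsilon_{\mathrm{premature}}$.
   Context: A two-way probabilistic finite automaton is a finite-state machine with a single read-only head on an input tape containing $\rhd w\lhd$ (end-markers $\rhd,\lhd$), which at each step may flip a fair coin and, depending on its state, the scanned symbol and the coin outcome, changes state and moves its head left, right, or not at all; it halts upon entering a halting state. $n=|w|$.
   Formalization: The desired bound $\varepsilon_{\mathrm{premature}}$ ranges over the positive rationals. -}

module Defs where

open import Data.Nat as ℕ using (ℕ; zero; suc)
open import Data.Integer as ℤ using (ℤ; +_)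
open import Data.Rational using (ℚ; 0ℚ; 1ℚ; _+_; _*_; _-_; _/_)
open import Data.Bool using (Bool; true; false; if_then_else_)
open import Data.Fin using (Fin)
open import Data.Vec using (Vec; lookup)
open import Data.Product using (_×_; _,_)
open import Relation.Nullary using (yes; no)

data TapeSym (k : ℕ) : Set where
  ▷ ◁ : TapeSym k
  sym : Fin k → TapeSym k

data Move : Set where
  left stay right : Move

-- A two-way probabilistic finite automaton over the input alphabet Fin k,
-- with q states. The transition depends on the state, scanned symbol and
-- the outcome of a fair coin flip.
record 2PFA (k : ℕ) : Set where
  field
    q       : ℕ
    start   : Fin q
    halting : Fin q → Bool
    δ       : Fin q → TapeSym k → Bool → Fin q × Move

-- Contents of the tape ▷ w ◁ at position i (0 = ▷, 1..n = w, n+1 and beyond = ◁).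
scan : ∀ {k n} → Vec (Fin k) n → ℕ → TapeSym k
scan w zero = ▷
scan {n = n} w (suc i) with i ℕ.<? n
... | yes p = sym (lookup w (Data.Fin.fromℕ< p))
... | no _ = ◁

moveHead : ℕ → ℕ → Move → ℕ
moveHead n zero    left  = zero
moveHead n (suc i) left  = i
moveHead n i       stay  = i
moveHead n i       right with i ℕ.<? suc n
... | yes _ = suc i
... | no _ = i

½ : ℚ
½ = + 1 / 2

-- Probability that, started in state s with head at position i on ▷ w ◁,
-- the machine enters a halting state within at most j further steps
-- (each step consumes one fair coin flip).
haltProbWithin : ∀ {k n} (M : 2PFA k) → Vec (Fin k) n →
                 Fin (2PFA.q M) → ℕ → ℕ → ℚ
haltProbWithin {n = n} M w s i j with 2PFA.halting M s
... | true = 1ℚ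
... | false = go j
  where
  go : ℕ → ℚ
  go zero    = 0ℚ
  go (suc j′) = ½ * next false + ½ * next true
    where
    next : Bool → ℚ
    next c with 2PFA.δ M s (scan w i) c
    ... | s′ , m = haltProbWithin M w s′ (moveHead n i m) j′

Pr[T≤_] : ∀ {k n} (M : 2PFA k) → Vec (Fin k) n → ℕ → ℚ
Pr[T≤_] M w j = haltProbWithin M w (2PFA.start M) zero j

Pr[T<_] : ∀ {k n} (M : 2PFA k) → Vec (Fin k) n → ℤ → ℚ
Pr[T<_] M w (+ zero)    = 0ℚ
Pr[T<_] M w (+ (suc j)) = Pr[T≤_] M w j
Pr[T<_] M w ℤ.-[1+ _ ]  = 0ℚ

-- Partial sums Σ_{j<K} Pr[T > j] of the series E[T] = Σ_{j≥0} Pr[T > j].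
expectedTimePartial : ∀ {k n} (M : 2PFA k) → Vec (Fin k) n → ℕ → ℚ
expectedTimePartial M w zero    = 0ℚ
expectedTimePartial M w (suc K) =
  expectedTimePartial M w K + (1ℚ - Pr[T≤_] M w K)

-- E[T] ≤ B, i.e. all partial sums of the (nonnegative) series are ≤ B.
ExpectedTime≤ : ∀ {k n} (M : 2PFA k) → Vec (Fin k) n → ℚ → Set
ExpectedTime≤ M w B = ∀ K → expectedTimePartial M w K Data.Rational.≤ B

BigO-pow : (ℕ → ℤ) → ℕ → Set
BigO-pow f t = Data.Product.∃ λ (C : ℕ) → Data.Product.∃ λ (N : ℕ) →
  ∀ n → N ℕ.≤ n → ℤ.∣ f n ∣ ℕ.≤ C ℕ.* (n ℕ.^ t)

module Submission where

-- The machine runs t nested symmetric random walks of the head between the end-markers, followed by a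
-- counter of m coin flips.  A walk at level l restarts at level 0 whenever it hits ▷ and climbs to
-- level l + 1 (after rewinding to ▷) when it hits ◁; hitting ◁ at the top level starts the counter,
-- which halts after m consecutive heads and otherwise rewinds to level 0.
--
-- Premature halting: the potential  progress  (i·N^l while walking at level l in cell i, N^l while
-- rewinding, N^t·2^r at counter value r, where N = n + 1) grows by at most 1 per step in expectation
-- and equals P = N^t·2^m on halting, so Pr[T ≤ j] ≤ j/P.  Choosing 2^m larger than the O(n^t)-bound
-- of f times the denominator of ε makes this at most ε for every j < f(n).
--
-- Running time: the potential  localWork  (i·(N − i) plus an offset for the levels still to climb)
-- decreases by at least 1 per step in expectation, up to D times the expected increase of progress.
-- Hence localWork + D·(P − progress) decreases by at least 1 per step in expectation, so its initial value
-- (2t + m)·N + D·P = O(n^(t+1)) bounds every partial sum Σ_{j<K} Pr[T > j] of E[T].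

open import Defs renaming (sym to letter)
open import Data.Nat using (ℕ; zero; suc; _+_; _*_; _^_; _∸_; _<_; _≤_; _<?_; z≤n; s≤s; s≤s⁻¹; NonZero)
open import Data.Nat.Properties
open import Data.Nat.Tactic.RingSolver using (solve-∀)
open import Data.Integer as ℤ using (ℤ; +_; -[1+_])
import Data.Integer.Properties as ℤₚ
open import Data.Rational as ℚ using (ℚ; mkℚ; 0ℚ; 1ℚ; ↧ₙ_; toℚᵘ)
  renaming (_≤_ to _≤ℚ_; _<_ to _<ℚ_; _/_ to _/ℚ_)
import Data.Rational.Properties as ℚₚ
import Data.Rational.Unnormalised as ℚᵘ
import Data.Rational.Unnormalised.Properties as ℚᵘₚ
open import Data.Rational.Solver using (module +-*-Solver)
open import Data.Nat.Coprimality using (1-coprimeTo) renaming (sym to coprime-sym)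
open import Data.Bool using (Bool; true; false)
open import Data.Fin as Fin using (Fin; toℕ; fromℕ<; _↑ˡ_; _↑ʳ_; splitAt)
open import Data.Fin.Properties using (toℕ<n; toℕ-fromℕ<; splitAt-↑ˡ; splitAt-↑ʳ)
open import Data.Vec using (Vec)
open import Data.Sum using (_⊎_; inj₁; inj₂; [_,_]′)
open import Data.Product using (Σ; ∃; ∃-syntax; _×_; _,_; proj₁; proj₂; map₁)
open import Function using (_∘_; const)
open import Relation.Nullary using (yes; no; contradiction)
open import Relation.Binary.PropositionalEquality

x+x≡2x : ∀ x → x + x ≡ 2 * x
x+x≡2x = solve-∀

m+o≡n⇒m≤n : ∀ {m n} o → m + o ≡ n → m ≤ n
m+o≡n⇒m≤n {m} o refl = m≤m+n m o

∸≡suc∸suc : ∀ {m n} → m < n → n ∸ m ≡ suc (n ∸ suc m)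
∸≡suc∸suc {zero}  {suc n} _         = refl
∸≡suc∸suc {suc m} {suc n} (s≤s m<n) = ∸≡suc∸suc m<n

n<2^n : ∀ n → n < 2 ^ n
n<2^n zero    = s≤s z≤n
n<2^n (suc n) = +-mono-≤ (m^n>0 2 n) (≤-trans (n<2^n n) (m≤m+n (2 ^ n) 0))

suc-^-≤ : ∀ {n} → 1 ≤ n → ∀ s → suc n ^ s ≤ 2 ^ s * n ^ s
suc-^-≤ 1≤n zero    = ≤-refl
suc-^-≤ {n} 1≤n (suc s) = begin
  suc n * suc n ^ s
    ≤⟨ *-mono-≤ (≤-trans (+-monoˡ-≤ n 1≤n) (≤-reflexive (x+x≡2x n))) (suc-^-≤ 1≤n s) ⟩
  (2 * n) * (2 ^ s * n ^ s)
    ≡⟨ regroup n (2 ^ s) (n ^ s) ⟩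
  2 * 2 ^ s * (n * n ^ s) ∎
  where
  open ≤-Reasoning
  regroup : ∀ n a b → (2 * n) * (a * b) ≡ 2 * a * (n * b)
  regroup = solve-∀

j*q≤x*2^[1+c*q] : ∀ {j} c x q → suc j ≤ c * x → j * q ≤ x * 2 ^ suc (c * q)
j*q≤x*2^[1+c*q] {j} c x q 1+j≤cx = begin
  j * q               ≤⟨ *-monoˡ-≤ q (≤-trans (n≤1+n j) 1+j≤cx) ⟩
  c * x * q           ≡⟨ regroup c x q ⟩
  x * (c * q)         ≤⟨ *-monoʳ-≤ x (≤-trans (n≤1+n (c * q)) (<⇒≤ (n<2^n (suc (c * q))))) ⟩
  x * 2 ^ suc (c * q) ∎
  where
  open ≤-Reasoning
  regroup : ∀ c x q → c * x * q ≡ x * (c * q)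
  regroup = solve-∀

sumBelow : (ℕ → ℕ) → ℕ → ℕ
sumBelow g zero    = 0
sumBelow g (suc a) = g a + sumBelow g a

≤-sumBelow : ∀ g {x a} → x < a → g x ≤ sumBelow g a
≤-sumBelow g {x} {suc a} x<1+a with m≤n⇒m<n∨m≡n (s≤s⁻¹ x<1+a)
... | inj₁ x<a  = ≤-trans (≤-sumBelow g x<a) (m≤n+m (sumBelow g a) (g a))
... | inj₂ refl = m≤m+n (g x) (sumBelow g a)

BigO-pow⇒bounded : ∀ f t → BigO-pow f t → ∃[ C ] ∀ n → ℤ.∣ f n ∣ ≤ C * suc n ^ t
BigO-pow⇒bounded f t (C , N₀ , bound) = C + S , bounded
  where
  S = sumBelow (ℤ.∣_∣ ∘ f) N₀
  bounded : ∀ n → ℤ.∣ f n ∣ ≤ (C + S) * suc n ^ t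
  bounded n with n <? N₀
  ... | yes n<N₀ = ≤-trans (≤-sumBelow (ℤ.∣_∣ ∘ f) n<N₀)
                     (≤-trans (m≤n+m S C) (m≤m*n (C + S) (suc n ^ t) {{m^n≢0 (suc n) t}}))
  ... | no  n≮N₀ = ≤-trans (bound n (≮⇒≥ n≮N₀)) (*-mono-≤ (m≤m+n C S) (^-monoˡ-≤ t (n≤1+n n)))

drift-shift-≤ : ∀ h₀ h₁ h j → h₀ + h₁ ≤ 2 * h + 2 → (h₀ + j) + (h₁ + j) ≤ 2 * (h + suc j)
drift-shift-≤ h₀ h₁ h j h₀+h₁≤ = begin
  (h₀ + j) + (h₁ + j)  ≡⟨ regroupˡ h₀ h₁ j ⟩
  (h₀ + h₁) + 2 * j    ≤⟨ +-monoˡ-≤ (2 * j) h₀+h₁≤ ⟩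
  2 * h + 2 + 2 * j    ≡⟨ regroupʳ h j ⟩
  2 * (h + suc j)      ∎
  where
  open ≤-Reasoning
  regroupˡ : ∀ a b j → (a + j) + (b + j) ≡ (a + b) + 2 * j
  regroupˡ = solve-∀
  regroupʳ : ∀ h j → 2 * h + 2 + 2 * j ≡ 2 * (h + suc j)
  regroupʳ = solve-∀

compensate-≤ : ∀ {u₀ u₁ h h₀ h₁} u D {P} → h ≤ P → h₀ ≤ P → h₁ ≤ P →
  2 + u₀ + u₁ + 2 * D * h ≤ 2 * u + D * (h₀ + h₁) →
  suc (u₀ + D * (P ∸ h₀)) + suc (u₁ + D * (P ∸ h₁)) ≤ 2 * (u + D * (P ∸ h))
compensate-≤ {u₀} {u₁} {h} {h₀} {h₁} u D {P} h≤P h₀≤P h₁≤P drift =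
  +-cancelʳ-≤ (D * h₀ + D * h₁ + 2 * D * h) _ _ (begin
    suc (u₀ + D * a) + suc (u₁ + D * b) + (D * h₀ + D * h₁ + 2 * D * h)
      ≡⟨ regroupˡ u₀ u₁ D a b h h₀ h₁ ⟩
    (2 + u₀ + u₁ + 2 * D * h) + (D * (a + h₀) + D * (b + h₁))
      ≤⟨ +-monoˡ-≤ _ drift ⟩
    (2 * u + D * (h₀ + h₁)) + (D * (a + h₀) + D * (b + h₁))
      ≡⟨ cong₂ (λ x y → (2 * u + D * (h₀ + h₁)) + (D * x + D * y)) (toP h₀≤P) (toP h₁≤P) ⟩
    (2 * u + D * (h₀ + h₁)) + (D * (c + h) + D * (c + h))
      ≡⟨ regroupʳ u D c h h₀ h₁ ⟩
    2 * (u + D * c) + (D * h₀ + D * h₁ + 2 * D * h) ∎)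
  where
  open ≤-Reasoning
  a = P ∸ h₀
  b = P ∸ h₁
  c = P ∸ h
  toP : ∀ {h′} → h′ ≤ P → (P ∸ h′) + h′ ≡ c + h
  toP h′≤P = trans (m∸n+n≡m h′≤P) (sym (m∸n+n≡m h≤P))
  regroupˡ : ∀ u₀ u₁ D a b h h₀ h₁ →
    suc (u₀ + D * a) + suc (u₁ + D * b) + (D * h₀ + D * h₁ + 2 * D * h) ≡
    (2 + u₀ + u₁ + 2 * D * h) + (D * (a + h₀) + D * (b + h₁))
  regroupˡ = solve-∀
  regroupʳ : ∀ u D c h h₀ h₁ →
    (2 * u + D * (h₀ + h₁)) + (D * (c + h) + D * (c + h)) ≡
    2 * (u + D * c) + (D * h₀ + D * h₁ + 2 * D * h)
  regroupʳ = solve-∀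

restart-or-double : ∀ a b → 1 + a * (2 * b) ≤ 2 * (a * b) + 2
restart-or-double a b = ≤-trans (≤-reflexive (reorder a b)) (+-monoʳ-≤ (2 * (a * b)) (s≤s z≤n))
  where
  reorder : ∀ a b → 1 + a * (2 * b) ≡ 2 * (a * b) + 1
  reorder = solve-∀

restart-≤ : ∀ {j u₁} n v e a b → j ≤ n → u₁ ≤ e * suc n →
  2 + (j + suc n + v) + u₁ + 2 * (suc n + v) * (a * b) ≤
  2 * (suc e * suc n) + (suc n + v) * (1 + a * (2 * b))
restart-≤ {j} {u₁} n v e a b j≤n u₁≤ = begin
  2 + (j + suc n + v) + u₁ + 2 * (suc n + v) * (a * b)
    ≤⟨ +-monoˡ-≤ _ (+-mono-≤ (+-monoʳ-≤ 2 (+-monoˡ-≤ v (+-monoˡ-≤ (suc n) j≤n))) u₁≤) ⟩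
  2 + (n + suc n + v) + e * suc n + 2 * (suc n + v) * (a * b)
    ≤⟨ m≤m+n _ (n + e * suc n) ⟩
  2 + (n + suc n + v) + e * suc n + 2 * (suc n + v) * (a * b) + (n + e * suc n)
    ≡⟨ balance n v e a b ⟩
  2 * (suc e * suc n) + (suc n + v) * (1 + a * (2 * b)) ∎
  where
  open ≤-Reasoning
  balance : ∀ n v e a b →
    2 + (n + suc n + v) + e * suc n + 2 * (suc n + v) * (a * b) + (n + e * suc n) ≡
    2 * (suc e * suc n) + (suc n + v) * (1 + a * (2 * b))
  balance = solve-∀

fromℕ : ℕ → ℚ
fromℕ n = + n /ℚ 1

fromℕ≡mkℚ : ∀ n → fromℕ n ≡ mkℚ (+ n) 0 (coprime-sym (1-coprimeTo n))
fromℕ≡mkℚ n = ℚₚ.normalize-coprime (coprime-sym (1-coprimeTo n))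

fromℕ-mono-≤ : ∀ {a b} → a ≤ b → fromℕ a ≤ℚ fromℕ b
fromℕ-mono-≤ {a} {b} a≤b rewrite fromℕ≡mkℚ a | fromℕ≡mkℚ b =
  ℚ.*≤* (subst₂ ℤ._≤_ (sym (ℤₚ.*-identityʳ (+ a))) (sym (ℤₚ.*-identityʳ (+ b))) (ℤ.+≤+ a≤b))

fromℕ-homo-+ : ∀ a b → fromℕ (a + b) ≡ fromℕ a ℚ.+ fromℕ b
fromℕ-homo-+ a b = ℚₚ.toℚᵘ-injective (ℚᵘₚ.≃-trans numerators (ℚᵘₚ.≃-sym (ℚₚ.toℚᵘ-homo-+ (fromℕ a) (fromℕ b))))
  where
  numerators : toℚᵘ (fromℕ (a + b)) ℚᵘ.≃ toℚᵘ (fromℕ a) ℚᵘ.+ toℚᵘ (fromℕ b)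
  numerators rewrite fromℕ≡mkℚ a | fromℕ≡mkℚ b | fromℕ≡mkℚ (a + b) =
    ℚᵘ.*≡* (cong (ℤ._* + 1) (sym (cong₂ ℤ._+_ (ℤₚ.*-identityʳ (+ a)) (ℤₚ.*-identityʳ (+ b)))))

fromℕ-homo-* : ∀ a b → fromℕ (a * b) ≡ fromℕ a ℚ.* fromℕ b
fromℕ-homo-* a b = ℚₚ.toℚᵘ-injective (ℚᵘₚ.≃-trans numerators (ℚᵘₚ.≃-sym (ℚₚ.toℚᵘ-homo-* (fromℕ a) (fromℕ b))))
  where
  numerators : toℚᵘ (fromℕ (a * b)) ℚᵘ.≃ toℚᵘ (fromℕ a) ℚᵘ.* toℚᵘ (fromℕ b)
  numerators rewrite fromℕ≡mkℚ a | fromℕ≡mkℚ b | fromℕ≡mkℚ (a * b) =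
    ℚᵘ.*≡* (cong (ℤ._* + 1) (ℤₚ.pos-* a b))

½-mono-≤ : ∀ {p q} → p ≤ℚ q → ½ ℚ.* p ≤ℚ ½ ℚ.* q
½-mono-≤ = ℚₚ.*-monoˡ-≤-nonNeg ½ {{ℚₚ.normalize-nonNeg 1 2}}

½-average-≤ : ∀ {p q} x y z → p ≤ℚ fromℕ x → q ≤ℚ fromℕ y → x + y ≤ 2 * z →
              ½ ℚ.* p ℚ.+ ½ ℚ.* q ≤ℚ fromℕ z
½-average-≤ {p} {q} x y z p≤x q≤y x+y≤2z = begin
  ½ ℚ.* p ℚ.+ ½ ℚ.* q                  ≤⟨ ℚₚ.+-mono-≤ (½-mono-≤ p≤x) (½-mono-≤ q≤y) ⟩
  ½ ℚ.* fromℕ x ℚ.+ ½ ℚ.* fromℕ y      ≡⟨ sym (ℚₚ.*-distribˡ-+ ½ (fromℕ x) (fromℕ y)) ⟩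
  ½ ℚ.* (fromℕ x ℚ.+ fromℕ y)          ≡⟨ cong (½ ℚ.*_) (sym (fromℕ-homo-+ x y)) ⟩
  ½ ℚ.* fromℕ (x + y)                  ≤⟨ ½-mono-≤ (fromℕ-mono-≤ x+y≤2z) ⟩
  ½ ℚ.* fromℕ (2 * z)                  ≡⟨ cong (½ ℚ.*_) (fromℕ-homo-* 2 z) ⟩
  ½ ℚ.* (fromℕ 2 ℚ.* fromℕ z)          ≡⟨ sym (ℚₚ.*-assoc ½ (fromℕ 2) (fromℕ z)) ⟩
  1ℚ ℚ.* fromℕ z                       ≡⟨ ℚₚ.*-identityˡ (fromℕ z) ⟩
  fromℕ z                              ∎
  where open ℚₚ.≤-Reasoning

0≤fromℕ : ∀ n → 0ℚ ≤ℚ fromℕ n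
0≤fromℕ n = fromℕ-mono-≤ (z≤n {n})

1≤↧ₙp*p : ∀ p → 0ℚ <ℚ p → 1ℚ ≤ℚ fromℕ (↧ₙ p) ℚ.* p
1≤↧ₙp*p (mkℚ (+ zero) _ _)  (ℚ.*<* (ℤ.+<+ ()))
1≤↧ₙp*p (mkℚ -[1+ _ ] _ _)  (ℚ.*<* ())
1≤↧ₙp*p p@(mkℚ (+ suc a) d _) _ =
  ℚₚ.toℚᵘ-cancel-≤ (ℚᵘₚ.≤-respʳ-≃ (ℚᵘₚ.≃-sym (ℚₚ.toℚᵘ-homo-* (fromℕ (suc d)) p)) unnormalised)
  where
  unnormalised : toℚᵘ 1ℚ ℚᵘ.≤ toℚᵘ (fromℕ (suc d)) ℚᵘ.* toℚᵘ p
  unnormalised rewrite fromℕ≡mkℚ (suc d) = ℚᵘ.*≤* (ℤ.+≤+ (s≤s (begin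
    d + 0 + 0           ≡⟨ trans (+-identityʳ (d + 0)) (+-identityʳ d) ⟩
    d                   ≤⟨ m≤m*n d (suc a) ⟩
    d * suc a           ≤⟨ m≤n+m (d * suc a) a ⟩
    a + d * suc a       ≡⟨ sym (*-identityʳ (a + d * suc a)) ⟩
    (a + d * suc a) * 1 ∎)))
    where open ≤-Reasoning


≤-by-denominator : ∀ {h ε} j P q .{{_ : NonZero P}} → 0ℚ <ℚ ε →
  h ℚ.* fromℕ P ≤ℚ fromℕ j → j * q ≤ P → 1ℚ ≤ℚ fromℕ q ℚ.* ε → h ≤ℚ ε
≤-by-denominator {h} {ε} j P q ε>0 hP≤j jq≤P 1≤qε =
  ℚₚ.*-cancelʳ-≤-pos (fromℕ P) {{ℚₚ.normalize-pos P 1}} (begin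
    h ℚ.* fromℕ P                  ≤⟨ hP≤j ⟩
    fromℕ j                        ≡⟨ sym (ℚₚ.*-identityʳ (fromℕ j)) ⟩
    fromℕ j ℚ.* 1ℚ                 ≤⟨ ℚₚ.*-monoˡ-≤-nonNeg (fromℕ j) {{ℚₚ.normalize-nonNeg j 1}} 1≤qε ⟩
    fromℕ j ℚ.* (fromℕ q ℚ.* ε)    ≡⟨ sym (ℚₚ.*-assoc (fromℕ j) (fromℕ q) ε) ⟩
    fromℕ j ℚ.* fromℕ q ℚ.* ε      ≡⟨ cong (ℚ._* ε) (sym (fromℕ-homo-* j q)) ⟩
    fromℕ (j * q) ℚ.* ε            ≤⟨ ℚₚ.*-monoʳ-≤-nonNeg ε {{ℚₚ.pos⇒nonNeg ε {{ℚ.positive ε>0}}}} (fromℕ-mono-≤ jq≤P) ⟩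
    fromℕ P ℚ.* ε                  ≡⟨ ℚₚ.*-comm (fromℕ P) ε ⟩
    ε ℚ.* fromℕ P                  ∎)
  where open ℚₚ.≤-Reasoning

moveHead-≤ : ∀ n i m → i ≤ suc n → moveHead n i m ≤ suc n
moveHead-≤ n zero    left  i≤ = z≤n
moveHead-≤ n (suc i) left  i≤ = ≤-trans (n≤1+n i) i≤
moveHead-≤ n zero    stay  i≤ = i≤
moveHead-≤ n (suc i) stay  i≤ = i≤
moveHead-≤ n zero    right i≤ = s≤s z≤n
moveHead-≤ n (suc i) right i≤ with suc i <? suc n
... | yes i<N = i<N
... | no  _   = i≤

module _ {k n} (M : 2PFA k) (w : Vec (Fin k) n) where
  open 2PFA M

  next : Fin q → ℕ → Bool → Fin q × ℕ
  next s i c = proj₁ (δ s (scan w i) c) , moveHead n i (proj₂ (δ s (scan w i) c))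

  after : (Fin q → ℕ → ℕ) → Fin q → ℕ → Bool → ℕ
  after Φ s i c = Φ (proj₁ (next s i c)) (proj₂ (next s i c))

  next-≤ : ∀ s i c → i ≤ suc n → proj₂ (next s i c) ≤ suc n
  next-≤ s i c = moveHead-≤ n i _

  Drift≤+1 : (Fin q → ℕ → ℕ) → Set
  Drift≤+1 H = ∀ s i → i ≤ suc n → halting s ≡ false →
               after H s i false + after H s i true ≤ 2 * H s i + 2

  Drift≤-1 : (Fin q → ℕ → ℕ) → Set
  Drift≤-1 Ψ = ∀ s i → i ≤ suc n → halting s ≡ false →
               suc (after Ψ s i false) + suc (after Ψ s i true) ≤ 2 * Ψ s i

  halting-status : ∀ s → halting s ≡ true ⊎ halting s ≡ false
  halting-status s with halting s
  ... | true  = inj₁ refl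
  ... | false = inj₂ refl

  haltProb : Fin q × ℕ → ℕ → ℚ
  haltProb (s , i) = haltProbWithin M w s i

  haltProb-halting : ∀ {s} i j → halting s ≡ true → haltProbWithin M w s i j ≡ 1ℚ
  haltProb-halting i j eq rewrite eq = refl

  haltProb-zero : ∀ {s} i → halting s ≡ false → haltProbWithin M w s i 0 ≡ 0ℚ
  haltProb-zero i eq rewrite eq = refl

  haltProb-suc : ∀ {s} i j → halting s ≡ false → haltProbWithin M w s i (suc j) ≡
    ½ ℚ.* haltProb (next s i false) j ℚ.+ ½ ℚ.* haltProb (next s i true) j
  haltProb-suc i j eq rewrite eq = refl

  haltProbWithin-≤ : (H : Fin q → ℕ → ℕ) (P : ℕ) → (∀ s i → halting s ≡ true → P ≤ H s i) →
    Drift≤+1 H → ∀ j s i → i ≤ suc n → haltProbWithin M w s i j ℚ.* fromℕ P ≤ℚ fromℕ (H s i + j)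
  haltProbWithin-≤ H P halted drift j s i i≤ with halting-status s
  ... | inj₁ stopped = begin
    haltProbWithin M w s i j ℚ.* fromℕ P ≡⟨ cong (ℚ._* fromℕ P) (haltProb-halting i j stopped) ⟩
    1ℚ ℚ.* fromℕ P                       ≡⟨ ℚₚ.*-identityˡ (fromℕ P) ⟩
    fromℕ P                              ≤⟨ fromℕ-mono-≤ (≤-trans (halted s i stopped) (m≤m+n (H s i) j)) ⟩
    fromℕ (H s i + j)                    ∎
    where open ℚₚ.≤-Reasoning
  haltProbWithin-≤ H P halted drift zero s i i≤ | inj₂ running = begin
    haltProbWithin M w s i 0 ℚ.* fromℕ P ≡⟨ cong (ℚ._* fromℕ P) (haltProb-zero i running) ⟩
    0ℚ ℚ.* fromℕ P                       ≡⟨ ℚₚ.*-zeroˡ (fromℕ P) ⟩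
    0ℚ                                   ≤⟨ 0≤fromℕ (H s i + 0) ⟩
    fromℕ (H s i + 0)                    ∎
    where open ℚₚ.≤-Reasoning
  haltProbWithin-≤ H P halted drift (suc j) s i i≤ | inj₂ running = begin
    haltProbWithin M w s i (suc j) ℚ.* fromℕ P
      ≡⟨ cong (ℚ._* fromℕ P) (haltProb-suc i j running) ⟩
    (½ ℚ.* haltProb (next s i false) j ℚ.+ ½ ℚ.* haltProb (next s i true) j) ℚ.* fromℕ P
      ≡⟨ ℚₚ.*-distribʳ-+ (fromℕ P) (½ ℚ.* haltProb (next s i false) j) (½ ℚ.* haltProb (next s i true) j) ⟩
    ½ ℚ.* haltProb (next s i false) j ℚ.* fromℕ P ℚ.+ ½ ℚ.* haltProb (next s i true) j ℚ.* fromℕ P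
      ≡⟨ cong₂ ℚ._+_ (ℚₚ.*-assoc ½ (haltProb (next s i false) j) (fromℕ P))
                     (ℚₚ.*-assoc ½ (haltProb (next s i true) j) (fromℕ P)) ⟩
    ½ ℚ.* (haltProb (next s i false) j ℚ.* fromℕ P) ℚ.+ ½ ℚ.* (haltProb (next s i true) j ℚ.* fromℕ P)
      ≤⟨ ½-average-≤ (after H s i false + j) (after H s i true + j) (H s i + suc j)
                     (after-≤ false) (after-≤ true)
                     (drift-shift-≤ (after H s i false) (after H s i true) (H s i) j (drift s i i≤ running)) ⟩
    fromℕ (H s i + suc j) ∎
    where
    open ℚₚ.≤-Reasoning
    after-≤ : ∀ c → haltProb (next s i c) j ℚ.* fromℕ P ≤ℚ fromℕ (after H s i c + j)
    after-≤ c = haltProbWithin-≤ H P halted drift j _ _ (next-≤ s i c i≤)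

  expectedTimePartialFrom : Fin q × ℕ → ℕ → ℚ
  expectedTimePartialFrom γ zero    = 0ℚ
  expectedTimePartialFrom γ (suc K) = expectedTimePartialFrom γ K ℚ.+ (1ℚ ℚ.- haltProb γ K)

  expectedTimePartial≡From : ∀ K → expectedTimePartial M w K ≡ expectedTimePartialFrom (start , 0) K
  expectedTimePartial≡From zero    = refl
  expectedTimePartial≡From (suc K) = cong (ℚ._+ (1ℚ ℚ.- Pr[T≤_] M w K)) (expectedTimePartial≡From K)

  expectedTimePartialFrom-halting : ∀ {s} i K → halting s ≡ true → expectedTimePartialFrom (s , i) K ≡ 0ℚ
  expectedTimePartialFrom-halting i zero    stopped = refl
  expectedTimePartialFrom-halting i (suc K) stopped
    rewrite expectedTimePartialFrom-halting i K stopped | haltProb-halting i K stopped = refl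

  expectedTimePartialFrom-suc : ∀ {s} i K → halting s ≡ false →
    expectedTimePartialFrom (s , i) (suc K) ≡
    ½ ℚ.* (1ℚ ℚ.+ expectedTimePartialFrom (next s i false) K) ℚ.+
    ½ ℚ.* (1ℚ ℚ.+ expectedTimePartialFrom (next s i true) K)
  expectedTimePartialFrom-suc i zero running rewrite haltProb-zero i running = refl
  expectedTimePartialFrom-suc i (suc K) running
    rewrite expectedTimePartialFrom-suc i K running | haltProb-suc i K running =
      regroup (expectedTimePartialFrom (next _ i false) K) (expectedTimePartialFrom (next _ i true) K)
              (haltProb (next _ i false) K) (haltProb (next _ i true) K)
    where
    open +-*-Solver
    regroup : ∀ x y a b →
      (½ ℚ.* (1ℚ ℚ.+ x) ℚ.+ ½ ℚ.* (1ℚ ℚ.+ y)) ℚ.+ (1ℚ ℚ.- (½ ℚ.* a ℚ.+ ½ ℚ.* b)) ≡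
      ½ ℚ.* (1ℚ ℚ.+ (x ℚ.+ (1ℚ ℚ.- a))) ℚ.+ ½ ℚ.* (1ℚ ℚ.+ (y ℚ.+ (1ℚ ℚ.- b)))
    regroup = solve 4 (λ x y a b →
      (con ½ :* (con 1ℚ :+ x) :+ con ½ :* (con 1ℚ :+ y)) :+ (con 1ℚ :- (con ½ :* a :+ con ½ :* b)) :=
      con ½ :* (con 1ℚ :+ (x :+ (con 1ℚ :- a))) :+ con ½ :* (con 1ℚ :+ (y :+ (con 1ℚ :- b)))) refl

  expectedTimePartialFrom-≤ : (Ψ : Fin q → ℕ → ℕ) → Drift≤-1 Ψ →
    ∀ K s i → i ≤ suc n → expectedTimePartialFrom (s , i) K ≤ℚ fromℕ (Ψ s i)
  expectedTimePartialFrom-≤ Ψ drift K s i i≤ with halting-status s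
  ... | inj₁ stopped = begin
    expectedTimePartialFrom (s , i) K ≡⟨ expectedTimePartialFrom-halting i K stopped ⟩
    0ℚ                                ≤⟨ 0≤fromℕ (Ψ s i) ⟩
    fromℕ (Ψ s i)                     ∎
    where open ℚₚ.≤-Reasoning
  expectedTimePartialFrom-≤ Ψ drift zero s i i≤ | inj₂ running = 0≤fromℕ (Ψ s i)
  expectedTimePartialFrom-≤ Ψ drift (suc K) s i i≤ | inj₂ running = begin
    expectedTimePartialFrom (s , i) (suc K)
      ≡⟨ expectedTimePartialFrom-suc i K running ⟩
    ½ ℚ.* (1ℚ ℚ.+ expectedTimePartialFrom (next s i false) K) ℚ.+
    ½ ℚ.* (1ℚ ℚ.+ expectedTimePartialFrom (next s i true) K)
      ≤⟨ ½-average-≤ (suc (after Ψ s i false)) (suc (after Ψ s i true)) (Ψ s i)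
                     (after-≤ false) (after-≤ true) (drift s i i≤ running) ⟩
    fromℕ (Ψ s i) ∎
    where
    open ℚₚ.≤-Reasoning
    after-≤ : ∀ c → 1ℚ ℚ.+ expectedTimePartialFrom (next s i c) K ≤ℚ fromℕ (suc (after Ψ s i c))
    after-≤ c = begin
      1ℚ ℚ.+ expectedTimePartialFrom (next s i c) K
        ≤⟨ ℚₚ.+-monoʳ-≤ 1ℚ (expectedTimePartialFrom-≤ Ψ drift K _ _ (next-≤ s i c i≤)) ⟩
      fromℕ 1 ℚ.+ fromℕ (after Ψ s i c)
        ≡⟨ sym (fromℕ-homo-+ 1 (after Ψ s i c)) ⟩
      fromℕ (suc (after Ψ s i c)) ∎

  CompensatedDrift : (u H : Fin q → ℕ → ℕ) → ℕ → Set
  CompensatedDrift u H D = ∀ s i → i ≤ suc n → halting s ≡ false →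
    2 + after u s i false + after u s i true + 2 * D * H s i ≤
    2 * u s i + D * (after H s i false + after H s i true)

  Drift≤-1-compensate : (u H : Fin q → ℕ → ℕ) (D P : ℕ) → (∀ s i → i ≤ suc n → H s i ≤ P) →
    CompensatedDrift u H D → Drift≤-1 (λ s i → u s i + D * (P ∸ H s i))
  Drift≤-1-compensate u H D P H≤P drift s i i≤ running =
    compensate-≤ (u s i) D (H≤P s i i≤) (H≤P _ _ (next-≤ s i false i≤)) (H≤P _ _ (next-≤ s i true i≤))
                 (drift s i i≤ running)

data NextIndex {m} (i : Fin m) : Set where
  sucAt  : (j : Fin m) → toℕ j ≡ suc (toℕ i) → NextIndex i
  isLast : m ≡ suc (toℕ i) → NextIndex i

nextIndex : ∀ {m} (i : Fin m) → NextIndex i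
nextIndex {m} i with suc (toℕ i) <? m
... | yes i+1<m = sucAt (fromℕ< i+1<m) (toℕ-fromℕ< i+1<m)
... | no  i+1≮m = isLast (≤-antisym (≮⇒≥ i+1≮m) (toℕ<n i))

module Machine (k t′ m′ : ℕ) where
  t m : ℕ
  t = suc t′
  m = suc m′

  data State : Set where
    walk back : Fin t → State
    count     : Fin m → State
    done      : State

  isDone : State → Bool
  isDone done = true
  isDone _    = false

  Q : ℕ
  Q = t + (t + (m + 1))

  encode : State → Fin Q
  encode (walk l)  = l ↑ˡ (t + (m + 1))
  encode (back l)  = t ↑ʳ (l ↑ˡ (m + 1))
  encode (count r) = t ↑ʳ (t ↑ʳ (r ↑ˡ 1))
  encode done      = t ↑ʳ (t ↑ʳ (m ↑ʳ Fin.zero))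

  decode : Fin Q → State
  decode = [ walk , [ back , [ count , const done ]′ ∘ splitAt m ]′ ∘ splitAt t ]′ ∘ splitAt t

  decode-encode : ∀ s → decode (encode s) ≡ s
  decode-encode (walk l)  rewrite splitAt-↑ˡ t l (t + (m + 1)) = refl
  decode-encode (back l)  rewrite splitAt-↑ʳ t (t + (m + 1)) (l ↑ˡ (m + 1))
                                | splitAt-↑ˡ t l (m + 1) = refl
  decode-encode (count r) rewrite splitAt-↑ʳ t (t + (m + 1)) (t ↑ʳ (r ↑ˡ 1))
                                | splitAt-↑ʳ t (m + 1) (r ↑ˡ 1) | splitAt-↑ˡ m r 1 = refl
  decode-encode done      rewrite splitAt-↑ʳ t (t + (m + 1)) (t ↑ʳ (m ↑ʳ Fin.zero))
                                | splitAt-↑ʳ t (m + 1) (m ↑ʳ Fin.zero) | splitAt-↑ʳ m 1 Fin.zero = refl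

  step : State → TapeSym k → Bool → State × Move
  step (walk l)  ▷          _     = walk Fin.zero , right
  step (walk l)  (letter _) false = walk l , left
  step (walk l)  (letter _) true  = walk l , right
  step (walk l)  ◁          _     with nextIndex l
  ... | sucAt l′ _ = back l′ , left
  ... | isLast _   = count Fin.zero , stay
  step (back l)  ▷          _     = walk l , right
  step (back l)  (letter _) _     = back l , left
  step (back l)  ◁          _     = back l , left
  step (count r) _          false = back Fin.zero , left
  step (count r) _          true  with nextIndex r
  ... | sucAt r′ _ = count r′ , stay
  ... | isLast _   = done , stay
  step done      _          _     = done , stay

  machine : 2PFA k
  machine = record
    { q       = Q
    ; start   = encode (walk Fin.zero)
    ; halting = isDone ∘ decode
    ; δ       = λ x σ c → map₁ encode (step (decode x) σ c)
    }

  module Potentials (n : ℕ) where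
    N P : ℕ
    N = suc n
    P = N ^ t * 2 ^ m

    P-nonZero : NonZero P
    P-nonZero = m*n≢0 (N ^ t) (2 ^ m) {{m^n≢0 N t}} {{m^n≢0 2 m}}

    data Scanned : ℕ → TapeSym k → Set where
      at▷      : Scanned 0 ▷
      atLetter : ∀ {i} a → i < n → Scanned (suc i) (letter a)
      at◁      : Scanned N ◁

    scanned : (w : Vec (Fin k) n) → ∀ i → i ≤ N → Scanned i (scan w i)
    scanned w zero    _         = at▷
    scanned w (suc i) (s≤s i≤n) with i <? n
    ... | yes i<n = atLetter _ i<n
    ... | no  i≮n = subst (λ j → Scanned (suc j) ◁) (≤-antisym (≮⇒≥ i≮n) i≤n) at◁

    moveHead-right : ∀ {i} → i < N → moveHead n i right ≡ suc i
    moveHead-right {zero}  _   = refl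
    moveHead-right {suc i} i<N with suc i <? N
    ... | yes _   = refl
    ... | no  i≮N = contradiction i<N i≮N

    moveHead-left-≤ : ∀ {i σ} → Scanned i σ → moveHead n i left ≤ n
    moveHead-left-≤ at▷             = z≤n
    moveHead-left-≤ (atLetter _ i<n) = <⇒≤ i<n
    moveHead-left-≤ at◁             = ≤-refl

    afterStep : (State → ℕ → ℕ) → State → ℕ → TapeSym k → Bool → ℕ
    afterStep Φ s i σ c = Φ (proj₁ (step s σ c)) (moveHead n i (proj₂ (step s σ c)))

    progress : State → ℕ → ℕ
    progress (walk l)  i = i * N ^ toℕ l
    progress (back l)  i = N ^ toℕ l
    progress (count r) i = N ^ t * 2 ^ toℕ r
    progress done      i = P

    progress-≤ : ∀ s i → i ≤ N → progress s i ≤ P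
    progress-≤ (walk l)  i i≤N = begin
      i * N ^ toℕ l  ≤⟨ *-monoˡ-≤ (N ^ toℕ l) i≤N ⟩
      N ^ suc (toℕ l) ≤⟨ ^-monoʳ-≤ N (toℕ<n l) ⟩
      N ^ t          ≤⟨ m≤m*n (N ^ t) (2 ^ m) {{m^n≢0 2 m}} ⟩
      P              ∎
      where open ≤-Reasoning
    progress-≤ (back l)  i i≤N = ≤-trans (^-monoʳ-≤ N (<⇒≤ (toℕ<n l))) (m≤m*n (N ^ t) (2 ^ m) {{m^n≢0 2 m}})
    progress-≤ (count r) i i≤N = *-monoʳ-≤ (N ^ t) (^-monoʳ-≤ 2 (<⇒≤ (toℕ<n r)))
    progress-≤ done      i i≤N = ≤-refl

    progress-drift : ∀ {i σ} s → Scanned i σ → isDone s ≡ false →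
      afterStep progress s i σ false + afterStep progress s i σ true ≤ 2 * progress s i + 2
    progress-drift (walk l) at▷ _ = ≤-refl
    progress-drift (walk l) (atLetter {i} _ i<n) _
      rewrite moveHead-right (s≤s i<n) =
        m≤n⇒m≤n+o 2 (≤-reflexive (neighbours i (N ^ toℕ l)))
      where
      neighbours : ∀ i x → i * x + suc (suc i) * x ≡ 2 * (suc i * x)
      neighbours = solve-∀
    progress-drift (walk l) at◁ _ with nextIndex l
    ... | sucAt l′ eq rewrite eq = m≤n⇒m≤n+o 2 (≤-reflexive (x+x≡2x (N * N ^ toℕ l)))
    ... | isLast eq = m≤n⇒m≤n+o 2 (≤-reflexive (begin-equality
      N ^ t * 1 + N ^ t * 1 ≡⟨ cong₂ _+_ (*-identityʳ (N ^ t)) (*-identityʳ (N ^ t)) ⟩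
      N ^ t + N ^ t         ≡⟨ x+x≡2x (N ^ t) ⟩
      2 * N ^ t             ≡⟨ cong (λ e → 2 * N ^ e) eq ⟩
      2 * (N * N ^ toℕ l)   ∎))
      where open ≤-Reasoning
    progress-drift (back l) at▷          _ = m≤n⇒m≤n+o 2 (≤-reflexive
      (trans (cong₂ _+_ (*-identityˡ (N ^ toℕ l)) (*-identityˡ (N ^ toℕ l))) (x+x≡2x (N ^ toℕ l))))
    progress-drift (back l) (atLetter _ _) _ = m≤n⇒m≤n+o 2 (≤-reflexive (x+x≡2x (N ^ toℕ l)))
    progress-drift (back l) at◁          _ = m≤n⇒m≤n+o 2 (≤-reflexive (x+x≡2x (N ^ toℕ l)))
    progress-drift (count r) _ _ with nextIndex r
    ... | sucAt r′ eq rewrite eq = restart-or-double (N ^ t) (2 ^ toℕ r)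
    ... | isLast eq rewrite cong (λ e → N ^ t * 2 ^ e) eq = restart-or-double (N ^ t) (2 ^ toℕ r)
    progress-drift done _ ()

    levelWork : ℕ → ℕ
    levelWork l = (2 * (t ∸ l) + m) * N

    localWork : State → ℕ → ℕ
    localWork (walk l)  i = i * (N ∸ i) + levelWork (toℕ l)
    localWork (back l)  i = i + N + levelWork (toℕ l)
    localWork (count r) i = (m ∸ toℕ r) * N
    localWork done      i = 0

    -- Opaque because unfolding D makes normalising the goals of the drift lemmas below very slow.
    opaque
      D : ℕ
      D = N + levelWork 0

      D≡ : D ≡ N + levelWork 0
      D≡ = refl

    CompensatedDriftAt : State → ℕ → TapeSym k → Set
    CompensatedDriftAt s i σ =
      2 + afterStep localWork s i σ false + afterStep localWork s i σ true + 2 * D * progress s i ≤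
      2 * localWork s i + D * (afterStep progress s i σ false + afterStep progress s i σ true)

    localWork-drift-walk : ∀ {i σ} l → Scanned i σ → CompensatedDriftAt (walk l) i σ
    localWork-drift-walk l at▷ =
      m+o≡n⇒m≤n (2 * levelWork (toℕ l)) (restart n (levelWork 0) (levelWork (toℕ l)) D D≡)
      where
      restart : ∀ n v y d → d ≡ suc n + v →
        2 + (1 * n + v) + (1 * n + v) + 2 * d * 0 + 2 * y ≡ 2 * (0 + y) + d * (1 + 1)
      restart n v y _ refl = identity n v y
        where
        identity : ∀ n v y →
          2 + (1 * n + v) + (1 * n + v) + 2 * (suc n + v) * 0 + 2 * y ≡ 2 * (0 + y) + (suc n + v) * (1 + 1)
        identity = solve-∀
    localWork-drift-walk l (atLetter {i} _ i<n)
      rewrite moveHead-right (s≤s i<n) | ∸≡suc∸suc (m<n⇒m<1+n i<n) | ∸≡suc∸suc i<n =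
        ≤-reflexive (diffuse i (n ∸ suc i) (levelWork (toℕ l)) (N ^ toℕ l) D)
      where
      diffuse : ∀ i e v x d →
        2 + (i * suc (suc e) + v) + (suc (suc i) * e + v) + 2 * d * (suc i * x) ≡
        2 * (suc i * suc e + v) + d * (i * x + suc (suc i) * x)
      diffuse = solve-∀
    localWork-drift-walk l at◁ with nextIndex l
    ... | sucAt l′ eq rewrite eq | n∸n≡0 n | ∸≡suc∸suc (toℕ<n l) =
      ≤-reflexive (climb n (t ∸ suc (toℕ l)) m (N ^ toℕ l) D)
      where
      climb : ∀ n e m x d →
        2 + (n + suc n + (2 * e + m) * suc n) + (n + suc n + (2 * e + m) * suc n) + 2 * d * (suc n * x) ≡
        2 * (suc n * 0 + (2 * suc e + m) * suc n) + d * (suc n * x + suc n * x)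
      climb = solve-∀
    ... | isLast eq rewrite cong (N ^_) (sym eq) | n∸n≡0 n | ∸≡suc∸suc (toℕ<n l) =
      m+o≡n⇒m≤n (4 * e * N + 4 * n + 2) (start-counting n e m (N ^ t) D)
      where
      e = t ∸ suc (toℕ l)
      start-counting : ∀ n e m x d →
        2 + m * suc n + m * suc n + 2 * d * x + (4 * e * suc n + 4 * n + 2) ≡
        2 * (suc n * 0 + (2 * suc e + m) * suc n) + d * (x * 1 + x * 1)
      start-counting = solve-∀

    retreat : ∀ i n v x d →
      2 + (i + suc n + v) + (i + suc n + v) + 2 * d * x ≡ 2 * (suc i + suc n + v) + d * (x + x)
    retreat = solve-∀

    localWork-drift-back : ∀ {i σ} l → Scanned i σ → CompensatedDriftAt (back l) i σ
    localWork-drift-back l at▷ = ≤-reflexive (return n (levelWork (toℕ l)) (N ^ toℕ l) D)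
      where
      return : ∀ n v x d →
        2 + (1 * n + v) + (1 * n + v) + 2 * d * x ≡ 2 * (0 + suc n + v) + d * (1 * x + 1 * x)
      return = solve-∀
    localWork-drift-back l (atLetter {i} _ _) = ≤-reflexive (retreat i n (levelWork (toℕ l)) (N ^ toℕ l) D)
    localWork-drift-back l at◁                = ≤-reflexive (retreat n n (levelWork (toℕ l)) (N ^ toℕ l) D)

    localWork-drift-count : ∀ {i σ} r → Scanned i σ → CompensatedDriftAt (count r) i σ
    localWork-drift-count r sc with nextIndex r
    ... | sucAt r′ eq rewrite eq | ∸≡suc∸suc (toℕ<n r) | D≡ =
      restart-≤ n (levelWork 0) (m ∸ suc (toℕ r)) (N ^ t) (2 ^ toℕ r) (moveHead-left-≤ sc) ≤-refl
    ... | isLast eq rewrite cong (λ e → N ^ t * 2 ^ e) eq | ∸≡suc∸suc (toℕ<n r) | D≡ =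
      restart-≤ n (levelWork 0) (m ∸ suc (toℕ r)) (N ^ t) (2 ^ toℕ r) (moveHead-left-≤ sc) z≤n

    localWork-drift : ∀ {i σ} s → Scanned i σ → isDone s ≡ false → CompensatedDriftAt s i σ
    localWork-drift (walk l)  sc _ = localWork-drift-walk l sc
    localWork-drift (back l)  sc _ = localWork-drift-back l sc
    localWork-drift (count r) sc _ = localWork-drift-count r sc

    done-progress : ∀ s i → isDone s ≡ true → P ≤ progress s i
    done-progress done i _ = ≤-refl

    module OnInput (w : Vec (Fin k) n) where
      progress-Drift≤+1 : Drift≤+1 machine w (progress ∘ decode)
      progress-Drift≤+1 x i i≤ running
        rewrite decode-encode (proj₁ (step (decode x) (scan w i) false))
              | decode-encode (proj₁ (step (decode x) (scan w i) true)) =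
          progress-drift (decode x) (scanned w i i≤) running

      localWork-CompensatedDrift : CompensatedDrift machine w (localWork ∘ decode) (progress ∘ decode) D
      localWork-CompensatedDrift x i i≤ running
        rewrite decode-encode (proj₁ (step (decode x) (scan w i) false))
              | decode-encode (proj₁ (step (decode x) (scan w i) true)) =
          localWork-drift (decode x) (scanned w i i≤) running

      Pr[T≤]-≤ : ∀ j → Pr[T≤_] machine w j ℚ.* fromℕ P ≤ℚ fromℕ j
      Pr[T≤]-≤ j =
        subst (λ s → Pr[T≤_] machine w j ℚ.* fromℕ P ≤ℚ fromℕ (progress s 0 + j)) (decode-encode (walk Fin.zero))
          (haltProbWithin-≤ machine w (progress ∘ decode) P (done-progress ∘ decode) progress-Drift≤+1
                            j (encode (walk Fin.zero)) 0 z≤n)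

      expectedTimePartial-≤ : ∀ K → expectedTimePartial machine w K ≤ℚ fromℕ (levelWork 0 + D * P)
      expectedTimePartial-≤ K =
        subst₂ _≤ℚ_ (sym (expectedTimePartial≡From machine w K))
          (cong (λ s → fromℕ (localWork s 0 + D * (P ∸ progress s 0))) (decode-encode (walk Fin.zero)))
          (expectedTimePartialFrom-≤ machine w workLeft workLeft-Drift≤-1 K (encode (walk Fin.zero)) 0 z≤n)
        where
        workLeft : Fin Q → ℕ → ℕ
        workLeft x i = localWork (decode x) i + D * (P ∸ progress (decode x) i)
        workLeft-Drift≤-1 : Drift≤-1 machine w workLeft
        workLeft-Drift≤-1 = Drift≤-1-compensate machine w (localWork ∘ decode) (progress ∘ decode) D P
                              (progress-≤ ∘ decode) localWork-CompensatedDrift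

    initialWork-≤ : 1 ≤ n → levelWork 0 + D * P ≤ suc (2 * t + m) * suc (2 ^ m) * 2 ^ suc t * n ^ suc t
    initialWork-≤ 1≤n = begin
      levelWork 0 + D * P
        ≤⟨ +-monoˡ-≤ (D * P) (≤-trans (m≤n+m (levelWork 0) N) (≤-reflexive (sym D≡))) ⟩
      D + D * P
        ≡⟨ sym (*-suc D P) ⟩
      D * suc P
        ≤⟨ *-monoʳ-≤ D (+-mono-≤ (m^n>0 N t) (≤-reflexive (*-comm (N ^ t) (2 ^ m)))) ⟩
      D * (suc (2 ^ m) * N ^ t)
        ≡⟨ cong (_* (suc (2 ^ m) * N ^ t)) D≡ ⟩
      B * N * (suc (2 ^ m) * N ^ t)
        ≡⟨ regroup B N (suc (2 ^ m)) (N ^ t) ⟩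
      B * suc (2 ^ m) * N ^ suc t
        ≤⟨ *-monoʳ-≤ (B * suc (2 ^ m)) (suc-^-≤ 1≤n (suc t)) ⟩
      B * suc (2 ^ m) * (2 ^ suc t * n ^ suc t)
        ≡⟨ sym (*-assoc (B * suc (2 ^ m)) (2 ^ suc t) (n ^ suc t)) ⟩
      B * suc (2 ^ m) * 2 ^ suc t * n ^ suc t ∎
      where
      open ≤-Reasoning
      B = suc (2 * t + m)
      regroup : ∀ b N c x → b * N * (c * x) ≡ b * c * (N * x)
      regroup = solve-∀

lemma1 : (k t : ℕ) → 0 < t → (f : ℕ → ℤ) → BigO-pow f t → (ε : ℚ) → 0ℚ <ℚ ε →
  Σ (2PFA k) λ M →
    (∃[ C ] ∃[ N ] ∀ n → N ≤ n → (w : Vec (Fin k) n) →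
        ExpectedTime≤ M w ((+ (C * n ^ suc t)) /ℚ 1))
    × (∀ n → (w : Vec (Fin k) n) → Pr[T<_] M w (f n) ≤ℚ ε)
lemma1 k (suc t′) _ f f∈O ε ε>0 with BigO-pow⇒bounded f (suc t′) f∈O
... | c , f≤ = machine , (suc (2 * t + m) * suc (2 ^ m) * 2 ^ suc t , 1 , expected) , premature
  where
  open Machine k t′ (c * ↧ₙ ε)
  open Potentials

  expected : ∀ n → 1 ≤ n → (w : Vec (Fin k) n) →
             ExpectedTime≤ machine w (fromℕ (suc (2 * t + m) * suc (2 ^ m) * 2 ^ suc t * n ^ suc t))
  expected n 1≤n w K = ℚₚ.≤-trans (OnInput.expectedTimePartial-≤ n w K) (fromℕ-mono-≤ (initialWork-≤ n 1≤n))

  premature : ∀ n (w : Vec (Fin k) n) → Pr[T<_] machine w (f n) ≤ℚ ε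
  premature n w with f n | f≤ n
  ... | + zero   | _    = ℚₚ.<⇒≤ ε>0
  ... | -[1+ _ ] | _    = ℚₚ.<⇒≤ ε>0
  ... | + suc j  | 1+j≤ = ≤-by-denominator j (P n) (↧ₙ ε) {{P-nonZero n}} ε>0 (OnInput.Pr[T≤]-≤ n w j)
                            (j*q≤x*2^[1+c*q] c (suc n ^ t) (↧ₙ ε) 1+j≤) (1≤↧ₙp*p ε ε>0)
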